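{- Let $(Q,Q')$ be a completely extended linear quiver with $n=|Q_0|\ge 2$, and let $\gamma$ be a perfect matching of its snake diagram. Then for every $i\in[0,n]$, exactly one edge of $\gamma$ lies in $Pl^{(i)}$.
   Context: A linear quiver $Q$ has vertices $v_1,\dots,v_n$ and exactly one arrow between $v_i$ and $v_{i+1}$ for each $i\in[1,n-1]$ (either direction), with no other arrows. Set $\delta_i=0$ if the arrow is $v_i\to v_{i+1}$ and $\delta_i=1$ otherwise. The completely extended linear quiver $Q'$ is obtained by attaching an oriented $3$-cycle to each arrow of $Q$ and to each of $v_1$ and $v_n$. The snake diagram is a planar graph made of unit-square tiles $G_1,\dots,G_n$. $G_2$ is glued to the right of $G_1$. For $i\in[2,n-1]$, $G_{i+1}$ is glued to the right of or on top of $G_i$, so that $G_{i-1},G_i,G_{i+1}$ lie in one row or column iff $\delta_{i-1}\ne\delta_i$. Vertices are the tile corners and edges are the tile sides. The main diagonal of each tile joins its top-left and bottom-right corners. It splits its sides into the lower-left pair (bottom, left) and the upper-right pair (top, right). Define the edge sets: - $Pl^{(0)}$ is the lower-left pair of $G_1$; - $Pl^{(n)}$ is the upper-right pair of $G_n$; - for $i\in[1,n-1]$, $Pl^{(i)}$ consists of the three edges lying in the parallelogram bounded by the main diagonals of $G_i$ and $G_{i+1}$: the common side of $G_i$ and $G_{i+1}$, the other upper-right side of $G_i$, and the other lower-left side of $G_{i+1}$. A perfect matching is a set of edges such that every vertex lies on exactly one of them. -}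

module Defs where

open import Data.Bool using (Bool; true; false; not; if_then_else_)
open import Data.Bool.Properties using () renaming (_≟_ to _≟ᵇ_)
open import Data.Nat using (ℕ; zero; suc; _+_; _∸_; _<?_)
open import Data.Nat.Properties using () renaming (_≟_ to _≟ℕ_)
open import Data.Fin using (Fin; fromℕ<)
open import Data.Product using (_×_; _,_)
open import Data.Product.Properties using (≡-dec)
open import Data.List using (List; []; _∷_; _++_; concatMap; upTo; length; filter)
open import Data.List.Membership.DecPropositional using ()
open import Relation.Binary.Definitions using (DecidableEquality)
open import Relation.Nullary using (yes; no; does)

Point : Set
Point = ℕ × ℕ

_≟P_ : DecidableEquality Point
_≟P_ = ≡-dec _≟ℕ_ _≟ℕ_

-- A unit edge of the lattice: (p , false) is the horizontal segment from p to p+(1,0);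
-- (p , true) is the vertical segment from p to p+(0,1).
Edge : Set
Edge = Point × Bool

_≟E_ : DecidableEquality Edge
_≟E_ = ≡-dec _≟P_ _≟ᵇ_

endpoints : Edge → List Point
endpoints ((x , y) , false) = (x , y) ∷ (suc x , y) ∷ []
endpoints ((x , y) , true)  = (x , y) ∷ (x , suc y) ∷ []

open import Data.List.Membership.DecPropositional _≟P_ using () renaming (_∈?_ to _∈P?_; _∈_ to _∈P_) public
open import Data.List.Membership.DecPropositional _≟E_ using () renaming (_∈?_ to _∈E?_; _∈_ to _∈E_) public

-- Extend an orientation vector δ : Fin (n-1) → Bool to a 1-based function on ℕ:
-- extend δ i = δ_i for i ∈ [1, n-1] (δ_i = 0/false iff arrow v_i → v_{i+1}); false elsewhere.
extend : ∀ {k} → (Fin k → Bool) → ℕ → Bool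
extend {k} δ zero = false
extend {k} δ (suc i) with i <? k
... | yes p = δ (fromℕ< p)
... | no _  = false

-- Step direction d_i from G_i to G_{i+1} (false = G_{i+1} glued to the right, true = on top).
-- d_1 = right; for i ≥ 2, G_{i-1},G_i,G_{i+1} collinear (d_i = d_{i-1}) iff δ_{i-1} ≠ δ_i.
dir : (ℕ → Bool) → ℕ → Bool
dir δ zero = false
dir δ (suc zero) = false
dir δ (suc (suc k)) =
  if does (δ (suc k) ≟ᵇ δ (suc (suc k))) then not (dir δ (suc k)) else dir δ (suc k)

move : Point → Bool → Point
move (x , y) false = (suc x , y)
move (x , y) true  = (x , suc y)

-- Lower-left corner of tile G_i (1-based); G_1 at the origin.
pos : (ℕ → Bool) → ℕ → Point
pos δ zero = (0 , 0)
pos δ (suc zero) = (0 , 0)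
pos δ (suc (suc k)) = move (pos δ (suc k)) (dir δ (suc k))

bottom left top right : Point → Edge
bottom (x , y) = ((x , y) , false)
left   (x , y) = ((x , y) , true)
top    (x , y) = ((x , suc y) , false)
right  (x , y) = ((suc x , y) , true)

corners : Point → List Point
corners (x , y) = (x , y) ∷ (suc x , y) ∷ (x , suc y) ∷ (suc x , suc y) ∷ []

lowerLeft upperRight sides : Point → List Edge
lowerLeft p  = bottom p ∷ left p ∷ []
upperRight p = top p ∷ right p ∷ []
sides p = lowerLeft p ++ upperRight p

tiles : ℕ → List ℕ
tiles n = Data.List.map suc (upTo n)

snakeVertices : (ℕ → Bool) → ℕ → List Point
snakeVertices δ n = concatMap (λ i → corners (pos δ i)) (tiles n)

snakeEdges : (ℕ → Bool) → ℕ → List Edge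
snakeEdges δ n = concatMap (λ i → sides (pos δ i)) (tiles n)

-- For 1 ≤ i ≤ n-1 it is upperRight(G_i) ∪ lowerLeft(G_{i+1}), i.e. the common side
-- of G_i,G_{i+1}, the other upper-right side of G_i and the other lower-left side of G_{i+1}.
Pl : (ℕ → Bool) → ℕ → ℕ → List Edge
Pl δ n zero = lowerLeft (pos δ 1)
Pl δ n (suc i) with suc i Data.Nat.≟ n
... | yes _ = upperRight (pos δ n)
... | no _  = upperRight (pos δ (suc i)) ++ lowerLeft (pos δ (suc (suc i)))

degreeIn : List Edge → Point → ℕ
degreeIn γ v = length (filter (λ e → v ∈P? endpoints e) γ)

open import Data.List.Relation.Unary.All using (All)
open import Data.List.Relation.Unary.Unique.Propositional using (Unique)
open import Relation.Binary.PropositionalEquality using (_≡_)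

record IsPerfectMatching (δ : ℕ → Bool) (n : ℕ) (γ : List Edge) : Set where
  field
    distinct : Unique γ
    edgesOfGraph : All (λ e → e ∈E snakeEdges δ n) γ
    exactlyOne : ∀ v → v ∈P snakeVertices δ n → degreeIn γ v ≡ 1

countIn : List Edge → List Edge → ℕ
countIn γ P = length (filter (λ e → e ∈E? P) γ)

-- Every edge joins two consecutive antidiagonals x + y = ℓ and x + y = ℓ + 1, and
-- tile G_{k+1} has its lower-left corner on antidiagonal k.  Hence Pl^{(i)} is the set of
-- edges leaving antidiagonal i, and the only snake vertices on antidiagonal m + 1 are the
-- two ends of the main diagonal of G_{m+1}.  Counting the edges of γ at these two
-- vertices gives c m + c (m + 1) = 2 for the number c i of edges of γ in Pl^{(i)}, while
-- the origin gives c 0 = 1.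

module Submission where

open import Defs
open import Data.Bool using (Bool; true; false)
open import Data.Nat using (ℕ; zero; suc; _+_; _≤_; _<_; _≟_; z≤n; s≤s)
open import Data.Nat.Properties using (+-suc; suc-injective; <-irrefl; 1+n≢n; m+n≡0⇒m≡0; m+n≡0⇒n≡0; <⇒≤; ≤-trans)
open import Data.Fin using (Fin)
open import Data.List using (List; []; _∷_; length; filter)
open import Data.List.Relation.Unary.Any using (here; there)
open import Data.List.Relation.Unary.Any.Properties using (map⁻; map⁺; concatMap⁻; concatMap⁺; ++⁻; ++⁺ˡ; ++⁺ʳ)
open import Data.List.Relation.Unary.All using (All; []; _∷_)
import Data.List.Relation.Unary.All as All
open import Data.List.Membership.Propositional using (find; lose)
open import Data.List.Membership.Propositional.Properties using (∈-upTo⁻; ∈-upTo⁺)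
open import Data.Product using (_×_; _,_; proj₁; ∃-syntax)
open import Data.Sum using (_⊎_; inj₁; inj₂)
import Data.Sum as Sum
open import Data.Empty using (⊥-elim)
open import Function.Bundles using (_⇔_; mk⇔; Equivalence)
open import Relation.Nullary using (yes; no; ¬_)
open import Relation.Nullary.Decidable using (_⊎-dec_)
open import Relation.Unary using (Pred; Decidable)
open import Relation.Binary.PropositionalEquality using (_≡_; _≢_; refl; sym; trans; cong; cong₂; module ≡-Reasoning)

module _ {a p q} {A : Set a} {P : Pred A p} {Q : Pred A q} (P? : Decidable P) (Q? : Decidable Q) where

  length-filter-cong : ∀ {xs} → All (λ x → P x ⇔ Q x) xs → length (filter P? xs) ≡ length (filter Q? xs)
  length-filter-cong {[]} [] = refl
  length-filter-cong {x ∷ xs} (P⇔Q ∷ rest) with P? x | Q? x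
  ... | yes _  | yes _  = cong suc (length-filter-cong rest)
  ... | yes Px | no ¬Qx = ⊥-elim (¬Qx (Equivalence.to P⇔Q Px))
  ... | no ¬Px | yes Qx = ⊥-elim (¬Px (Equivalence.from P⇔Q Qx))
  ... | no _   | no _   = length-filter-cong rest

  length-filter-⊎ : (∀ {x} → P x → ¬ Q x) → ∀ xs →
    length (filter P? xs) + length (filter Q? xs) ≡ length (filter (λ x → P? x ⊎-dec Q? x) xs)
  length-filter-⊎ disjoint [] = refl
  length-filter-⊎ disjoint (x ∷ xs) with P? x | Q? x
  ... | yes Px | yes Qx = ⊥-elim (disjoint Px Qx)
  ... | yes _  | no _   = cong suc (length-filter-⊎ disjoint xs)
  ... | no _   | yes _  = trans (+-suc _ _) (cong suc (length-filter-⊎ disjoint xs))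
  ... | no _   | no _   = length-filter-⊎ disjoint xs

level : Point → ℕ
level (x , y) = x + y

topLeft bottomRight : Point → Point
topLeft (x , y) = (x , suc y)
bottomRight (x , y) = (suc x , y)

level-topLeft : ∀ p → level (topLeft p) ≡ suc (level p)
level-topLeft (x , y) = +-suc x y

level-move : ∀ p d → level (move p d) ≡ suc (level p)
level-move p false = refl
level-move p true = level-topLeft p

topLeft≢bottomRight : ∀ p → topLeft p ≢ bottomRight p
topLeft≢bottomRight p eq = 1+n≢n (sym (cong proj₁ eq))

move-on-diagonal : ∀ p d → move p d ≡ topLeft p ⊎ move p d ≡ bottomRight p
move-on-diagonal p false = inj₂ refl
move-on-diagonal p true = inj₁ refl

topRight : Point → Point
topRight (x , y) = (suc x , suc y)

level-topRight : ∀ p → level (topRight p) ≡ suc (suc (level p))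
level-topRight (x , y) = cong suc (+-suc x y)

topRight-on-next-diagonal : ∀ p d → topRight p ≡ topLeft (move p d) ⊎ topRight p ≡ bottomRight (move p d)
topRight-on-next-diagonal p false = inj₁ refl
topRight-on-next-diagonal p true = inj₂ refl

∈-endpoints⁻ : ∀ {v p d} → v ∈P endpoints (p , d) → v ≡ p ⊎ v ≡ move p d
∈-endpoints⁻ {d = false} (here eq) = inj₁ eq
∈-endpoints⁻ {d = false} (there (here eq)) = inj₂ eq
∈-endpoints⁻ {d = true} (here eq) = inj₁ eq
∈-endpoints⁻ {d = true} (there (here eq)) = inj₂ eq

source∈endpoints : ∀ p d → p ∈P endpoints (p , d)
source∈endpoints p false = here refl
source∈endpoints p true = here refl

target∈endpoints : ∀ p d → move p d ∈P endpoints (p , d)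
target∈endpoints p false = there (here refl)
target∈endpoints p true = there (here refl)

endpoints-level-injective : ∀ {v w p d} → v ∈P endpoints (p , d) → w ∈P endpoints (p , d) →
  level v ≡ level w → v ≡ w
endpoints-level-injective {p = p} {d} v∈ w∈ eq with ∈-endpoints⁻ v∈ | ∈-endpoints⁻ w∈
... | inj₁ refl | inj₁ refl = refl
... | inj₂ refl | inj₂ refl = refl
... | inj₁ refl | inj₂ refl = ⊥-elim (1+n≢n (sym (trans eq (level-move p d))))
... | inj₂ refl | inj₁ refl = ⊥-elim (1+n≢n (trans (sym (level-move p d)) eq))

source-level : ∀ {v p d m} → v ∈P endpoints (p , d) → level v ≡ suc m → level p ≡ m ⊎ level p ≡ suc m
source-level {p = p} {d} v∈ lv with ∈-endpoints⁻ v∈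
... | inj₁ refl = inj₂ lv
... | inj₂ refl = inj₁ (suc-injective (trans (sym (level-move p d)) lv))

origin∈endpoints⇔ : ∀ p d → (0 , 0) ∈P endpoints (p , d) ⇔ level p ≡ 0
origin∈endpoints⇔ (x , y) d = mk⇔ to from
  where
  to : (0 , 0) ∈P endpoints ((x , y) , d) → x + y ≡ 0
  to o∈ with ∈-endpoints⁻ o∈
  ... | inj₁ refl = refl
  ... | inj₂ eq with trans (sym (level-move (x , y) d)) (cong level (sym eq))
  ... | ()
  from : x + y ≡ 0 → (0 , 0) ∈P endpoints ((x , y) , d)
  from x+y≡0 rewrite m+n≡0⇒m≡0 x x+y≡0 | m+n≡0⇒n≡0 x x+y≡0 = source∈endpoints (0 , 0) d

sides-⊆-corners : ∀ {q e v} → e ∈E sides q → v ∈P endpoints e → v ∈P corners q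
sides-⊆-corners (here refl) (here eq) = here eq
sides-⊆-corners (here refl) (there (here eq)) = there (here eq)
sides-⊆-corners (there (here refl)) (here eq) = here eq
sides-⊆-corners (there (here refl)) (there (here eq)) = there (there (here eq))
sides-⊆-corners (there (there (here refl))) (here eq) = there (there (here eq))
sides-⊆-corners (there (there (here refl))) (there (here eq)) = there (there (there (here eq)))
sides-⊆-corners (there (there (there (here refl)))) (here eq) = there (here eq)
sides-⊆-corners (there (there (there (here refl)))) (there (here eq)) = there (there (there (here eq)))

lowerLeft-level : ∀ {q e} → e ∈E lowerLeft q → level (proj₁ e) ≡ level q
lowerLeft-level (here refl) = refl
lowerLeft-level (there (here refl)) = refl

upperRight-level : ∀ {q e} → e ∈E upperRight q → level (proj₁ e) ≡ suc (level q)
upperRight-level {q} (here refl) = level-topLeft q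
upperRight-level (there (here refl)) = refl

module Snake (D : ℕ → Bool) (n : ℕ) where

  tile : ℕ → Point
  tile k = pos D (suc k)

  level-tile : ∀ k → level (tile k) ≡ k
  level-tile zero = refl
  level-tile (suc k) = trans (level-move (tile k) (dir D (suc k))) (cong suc (level-tile k))

  level-topLeft-tile : ∀ k → level (topLeft (tile k)) ≡ suc k
  level-topLeft-tile k = trans (level-topLeft (tile k)) (cong suc (level-tile k))

  level-bottomRight-tile : ∀ k → level (bottomRight (tile k)) ≡ suc k
  level-bottomRight-tile k = cong suc (level-tile k)

  corner-on-diagonal : ∀ j m {v} → v ∈P corners (tile j) → level v ≡ suc m →
    v ≡ topLeft (tile m) ⊎ v ≡ bottomRight (tile m)
  corner-on-diagonal j m (here refl) lv with trans (sym (level-tile j)) lv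
  ... | refl = move-on-diagonal (tile m) (dir D (suc m))
  corner-on-diagonal j m (there (here refl)) lv with suc-injective (trans (sym (level-bottomRight-tile j)) lv)
  ... | refl = inj₂ refl
  corner-on-diagonal j m (there (there (here refl))) lv with suc-injective (trans (sym (level-topLeft-tile j)) lv)
  ... | refl = inj₁ refl
  corner-on-diagonal j m (there (there (there (here refl)))) lv
    with suc-injective (trans (sym lv) (trans (level-topRight (tile j)) (cong (λ k → suc (suc k)) (level-tile j))))
  ... | refl = topRight-on-next-diagonal (tile j) (dir D (suc j))

  snakeEdge⁻ : ∀ {e} → e ∈E snakeEdges D n → ∃[ j ] j < n × e ∈E sides (tile j)
  snakeEdge⁻ e∈ with find (map⁻ (concatMap⁻ (λ i → sides (pos D i)) e∈))
  ... | j , j∈ , e∈sides = j , ∈-upTo⁻ j∈ , e∈sides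

  snakeVertex⁺ : ∀ {j v} → j < n → v ∈P corners (tile j) → v ∈P snakeVertices D n
  snakeVertex⁺ {v = v} j<n v∈ =
    concatMap⁺ (λ i → corners (pos D i)) (map⁺ (lose {P = λ k → v ∈P corners (tile k)} (∈-upTo⁺ j<n) v∈))

  snakeEndpoint-on-diagonal : ∀ {e v m} → e ∈E snakeEdges D n → v ∈P endpoints e → level v ≡ suc m →
    v ≡ topLeft (tile m) ⊎ v ≡ bottomRight (tile m)
  snakeEndpoint-on-diagonal {m = m} e∈ v∈ lv with snakeEdge⁻ e∈
  ... | j , _ , e∈sides = corner-on-diagonal j m (sides-⊆-corners e∈sides v∈) lv

  Pl-level : ∀ i {e} → e ∈E Pl D n i → level (proj₁ e) ≡ i
  Pl-level zero e∈ = lowerLeft-level e∈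
  Pl-level (suc i) e∈ with suc i ≟ n
  ... | yes refl = trans (upperRight-level e∈) (cong suc (level-tile i))
  ... | no _ with ++⁻ (upperRight (tile i)) e∈
  ...   | inj₁ e∈ur = trans (upperRight-level e∈ur) (cong suc (level-tile i))
  ...   | inj₂ e∈ll = trans (lowerLeft-level e∈ll) (level-tile (suc i))

  lowerLeft⊆Pl : ∀ {j e} → j < n → e ∈E lowerLeft (tile j) → e ∈E Pl D n j
  lowerLeft⊆Pl {zero} j<n e∈ = e∈
  lowerLeft⊆Pl {suc i} j<n e∈ with suc i ≟ n
  ... | yes refl = ⊥-elim (<-irrefl refl j<n)
  ... | no _ = ++⁺ʳ (upperRight (tile i)) e∈

  upperRight⊆Pl : ∀ {j e} → j < n → e ∈E upperRight (tile j) → e ∈E Pl D n (suc j)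
  upperRight⊆Pl {j} j<n e∈ with suc j ≟ n
  ... | yes refl = e∈
  ... | no _ = ++⁺ˡ e∈

  snakeEdge∈Pl : ∀ {e} → e ∈E snakeEdges D n → e ∈E Pl D n (level (proj₁ e))
  snakeEdge∈Pl e∈ with snakeEdge⁻ e∈
  ... | j , j<n , e∈sides with ++⁻ (lowerLeft (tile j)) e∈sides
  ...   | inj₁ e∈ll rewrite lowerLeft-level e∈ll | level-tile j = lowerLeft⊆Pl j<n e∈ll
  ...   | inj₂ e∈ur rewrite upperRight-level e∈ur | level-tile j = upperRight⊆Pl j<n e∈ur

  ∈Pl⇔level : ∀ i {e} → e ∈E snakeEdges D n → e ∈E Pl D n i ⇔ level (proj₁ e) ≡ i
  ∈Pl⇔level i e∈ = mk⇔ (Pl-level i) (λ { refl → snakeEdge∈Pl e∈ })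

  diagonal-ends-not-both : ∀ m {e} → topLeft (tile m) ∈P endpoints e → ¬ bottomRight (tile m) ∈P endpoints e
  diagonal-ends-not-both m tl∈ br∈ = topLeft≢bottomRight (tile m)
    (endpoints-level-injective tl∈ br∈ (trans (level-topLeft-tile m) (sym (level-bottomRight-tile m))))

  diagonal-incidence : ∀ m {e} → e ∈E snakeEdges D n →
    (topLeft (tile m) ∈P endpoints e ⊎ bottomRight (tile m) ∈P endpoints e) ⇔ (level (proj₁ e) ≡ m ⊎ level (proj₁ e) ≡ suc m)
  diagonal-incidence m {p , d} e∈ = mk⇔
    Sum.[ (λ tl∈ → source-level tl∈ (level-topLeft-tile m)) , (λ br∈ → source-level br∈ (level-bottomRight-tile m)) ]
    Sum.[ (λ lp → incident (target∈endpoints p d) (trans (level-move p d) (cong suc lp))) , incident (source∈endpoints p d) ]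
    where
    incident : ∀ {v} → v ∈P endpoints (p , d) → level v ≡ suc m →
      topLeft (tile m) ∈P endpoints (p , d) ⊎ bottomRight (tile m) ∈P endpoints (p , d)
    incident v∈ lv = Sum.map (λ { refl → v∈ }) (λ { refl → v∈ }) (snakeEndpoint-on-diagonal e∈ v∈ lv)

  module Counting (γ : List Edge) (matching : IsPerfectMatching D n γ) where
    open IsPerfectMatching matching

    edgesAtLevel : ℕ → ℕ
    edgesAtLevel i = length (filter (λ e → level (proj₁ e) ≟ i) γ)

    edgesAtLevel-zero : 0 < n → edgesAtLevel 0 ≡ 1
    edgesAtLevel-zero 0<n = begin
      edgesAtLevel 0
        ≡⟨ length-filter-cong _ _ {γ} (All.tabulate (λ { {p , d} _ → origin∈endpoints⇔ p d })) ⟨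
      degreeIn γ (0 , 0)
        ≡⟨ exactlyOne (0 , 0) (snakeVertex⁺ 0<n (here refl)) ⟩
      1 ∎
      where open ≡-Reasoning

    edgesAtLevel-consecutive : ∀ m → m < n → edgesAtLevel m + edgesAtLevel (suc m) ≡ 2
    edgesAtLevel-consecutive m m<n = begin
      edgesAtLevel m + edgesAtLevel (suc m)
        ≡⟨ length-filter-⊎ _ _ (λ l≡m l≡1+m → 1+n≢n (trans (sym l≡1+m) l≡m)) γ ⟩
      length (filter (λ e → (level (proj₁ e) ≟ m) ⊎-dec (level (proj₁ e) ≟ suc m)) γ)
        ≡⟨ length-filter-cong _ _ (All.map (diagonal-incidence m) edgesOfGraph) ⟨
      length (filter (λ e → (topLeft (tile m) ∈P? endpoints e) ⊎-dec (bottomRight (tile m) ∈P? endpoints e)) γ)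
        ≡⟨ length-filter-⊎ _ _ (diagonal-ends-not-both m) γ ⟨
      degreeIn γ (topLeft (tile m)) + degreeIn γ (bottomRight (tile m))
        ≡⟨ cong₂ _+_ (exactlyOne _ (snakeVertex⁺ m<n (there (there (here refl)))))
                     (exactlyOne _ (snakeVertex⁺ m<n (there (here refl)))) ⟩
      2 ∎
      where open ≡-Reasoning

    edgesAtLevel≡1 : 0 < n → ∀ i → i ≤ n → edgesAtLevel i ≡ 1
    edgesAtLevel≡1 0<n zero _ = edgesAtLevel-zero 0<n
    edgesAtLevel≡1 0<n (suc m) m<n =
      suc-injective (trans (cong (_+ edgesAtLevel (suc m)) (sym (edgesAtLevel≡1 0<n m (<⇒≤ m<n))))
                           (edgesAtLevel-consecutive m m<n))

    countIn-Pl : ∀ i → countIn γ (Pl D n i) ≡ edgesAtLevel i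
    countIn-Pl i = length-filter-cong _ _ (All.map (∈Pl⇔level i) edgesOfGraph)

lemma5p1 : (n : ℕ) → 2 ≤ n → (δ : Fin (n Data.Nat.∸ 1) → Bool) → (γ : List Edge)
    → IsPerfectMatching (extend δ) n γ
    → (i : ℕ) → i ≤ n → countIn γ (Pl (extend δ) n i) ≡ 1
lemma5p1 n 2≤n δ γ matching i i≤n = begin
  countIn γ (Pl (extend δ) n i) ≡⟨ countIn-Pl i ⟩
  edgesAtLevel i                ≡⟨ edgesAtLevel≡1 (≤-trans (s≤s z≤n) 2≤n) i i≤n ⟩
  1                             ∎
  where
  open Snake.Counting (extend δ) n γ matching
  open ≡-Reasoning
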